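{- Let $q$ be a prime power and $1\le t\le s$. If there is a linear $(t,s,q)$-AONT, then there is a linear $(s,s-t,t,q)$-resilient function.
   Context: A linear $(t,s,q)$-AONT is an invertible $s\times s$ matrix $M$ over $\mathbb{F}_q$ such that the map $\mathbf{y}\mapsto\mathbf{y}M$ is an all-or-nothing transform with parameter $t$; equivalently (a known fact), an invertible $s\times s$ matrix over $\mathbb{F}_q$ every $t\times t$ submatrix of which is invertible. For a finite set $X$ with $|X|=v$, an $(n,m,t,v)$-resilient function is a function $g: X^n\to X^m$ such that if any $t$ of the $n$ input values are fixed and the remaining $n-t$ inputs are chosen independently and uniformly at random, then every output $m$-tuple occurs with probability exactly $1/v^m$. An $(n,m,t,q)$-resilient function $f$ over $\mathbb{F}_q$ is linear if $f(\mathbf{x}) = \mathbf{x}N^T$ for some $m\times n$ matrix $N$ over $\mathbb{F}_q$. -}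

module Defs where

open import Data.Nat using (ℕ; zero; suc; _*_; _^_)
open import Data.Nat.Primality using (Prime)
open import Data.Fin using (Fin; zero; suc)
open import Data.Fin.Properties using (all?) renaming (_≟_ to _≟ᶠ_)
open import Data.List using (List; []; _∷_; map; concatMap; filter; length)
open import Data.Product using (Σ; ∃; _×_; _,_)
open import Data.Empty using (⊥)
open import Relation.Nullary using (¬_; Dec; yes; no)
open import Relation.Nullary.Decidable using (_×-dec_)
open import Relation.Binary.PropositionalEquality using (_≡_; refl; sym; trans; cong)
open import Relation.Binary.Definitions using (DecidableEquality)
open import Algebra.Structures using (IsCommutativeRing)
open import Function.Bundles using (_↔_; Inverse)
open import Function.Definitions using (Injective)

IsPrimePower : ℕ → Set
IsPrimePower q = Σ ℕ λ p → Σ ℕ λ k → Prime p × (q ≡ p ^ suc k)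

record FiniteField (q : ℕ) : Set₁ where
  infixl 6 _+_
  infixl 7 _*ᶠ_
  field
    Carrier : Set
    _+_ _*ᶠ_ : Carrier → Carrier → Carrier
    -_ : Carrier → Carrier
    0# 1# : Carrier
    isCommutativeRing : IsCommutativeRing _≡_ _+_ _*ᶠ_ -_ 0# 1#
    0≢1 : ¬ (0# ≡ 1#)
    inverse : ∀ x → ¬ (x ≡ 0#) → Σ Carrier λ y → x *ᶠ y ≡ 1#
    enum : Fin q ↔ Carrier

  _≟_ : DecidableEquality Carrier
  x ≟ y with Inverse.from enum x ≟ᶠ Inverse.from enum y
  ... | yes e = yes (trans (sym (tf x)) (trans (cong (Inverse.to enum) e) (tf y)))
    where
    tf : ∀ z → Inverse.to enum (Inverse.from enum z) ≡ z
    tf z = Inverse.inverseˡ enum refl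
  ... | no ne = no λ e → ne (cong (Inverse.from enum) e)

  elements : List Carrier
  elements = map (Inverse.to enum) (Data.List.tabulate {n = q} (λ i → i))
    where import Data.List

  sumF : ∀ {n} → (Fin n → Carrier) → Carrier
  sumF {zero}  f = 0#
  sumF {suc n} f = f zero + sumF (λ i → f (suc i))

  Mat : ℕ → ℕ → Set
  Mat m n = Fin m → Fin n → Carrier

  _⊗_ : ∀ {l m n} → Mat l m → Mat m n → Mat l n
  (A ⊗ B) i k = sumF λ j → A i j *ᶠ B j k

  I : ∀ {n} → Mat n n
  I i j with i ≟ᶠ j
  ... | yes _ = 1#
  ... | no  _ = 0#

  Invertible : ∀ {n} → Mat n n → Set
  Invertible {n} M = Σ (Mat n n) λ N →
    (∀ i j → (M ⊗ N) i j ≡ I i j) × (∀ i j → (N ⊗ M) i j ≡ I i j)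

  LinearAONT : ℕ → ℕ → Set
  LinearAONT t s = Σ (Mat s s) λ M → Invertible M ×
    ((r c : Fin t → Fin s) → Injective _≡_ _≡_ r → Injective _≡_ _≡_ c →
       Invertible (λ i j → M (r i) (c j)))

  Vect : ℕ → Set
  Vect n = Fin n → Carrier

  allVects : (n : ℕ) → List (Vect n)
  allVects zero = (λ ()) ∷ []
  allVects (suc n) = concatMap (λ c → map (λ f → cons c f) (allVects n)) elements
    where
    cons : Carrier → Vect n → Vect (suc n)
    cons c f zero = c
    cons c f (suc i) = f i

  countFix : ∀ {n m t} → (Vect n → Vect m) → (Fin t → Fin n) → Vect t → Vect m → ℕ
  countFix {n} g T a y =
    length (filter (λ x → all? (λ i → x (T i) ≟ a i) ×-dec all? (λ j → g x j ≟ y j))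
                   (allVects n))

  -- (n,m,t,q)-resilient function: fixing any t of the n inputs (at any
  -- values) and choosing the other n-t uniformly, every output m-tuple
  -- occurs with probability exactly 1/q^m, i.e.
  --   countFix g T a y / q^(n-t) = 1 / q^m
  Resilient : (n m t : ℕ) → (Vect n → Vect m) → Set
  Resilient n m t g = (T : Fin t → Fin n) → Injective _≡_ _≡_ T →
    (a : Vect t) (y : Vect m) → countFix g T a y * q ^ m ≡ q ^ (n ∸ t)
    where open import Data.Nat using (_∸_)

  LinearResilient : (n m t : ℕ) → Set
  LinearResilient n m t = Σ (Mat m n) λ N →
    Resilient n m t (λ x j → sumF λ i → x i *ᶠ N j i)

{-# OPTIONS --safe #-}
-- Let M be the AONT, M⁻¹ its inverse, and take f(x) to be the last s − t coordinates of x M⁻¹.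
-- Writing x = w M, prescribing f(x) = y fixes the tail of w to y, and then prescribing x on a
-- t-set T of positions is a linear system for the head of w whose matrix is the t × t minor of M
-- on the first t rows and the columns T.  That minor is invertible, so every fibre of
-- x ↦ (x restricted to T, f(x)) is a single point, which is exactly t-resilience.
module Submission where

open import Defs
open import Data.Nat using (ℕ; _≤_; _∸_; _*_; _^_)
import Data.Nat as ℕ
open import Data.Nat.Properties using (+-0-commutativeMonoid; *-identityˡ; m+n∸m≡n; m+[n∸m]≡n)
import Data.Nat.ListAction as Listℕ
open import Data.Fin using (Fin; zero; suc; _↑ˡ_; _↑ʳ_; splitAt) renaming (_≟_ to _≟ᶠ_)
open import Data.Fin.Properties using (↑ˡ-injective; punchInᵢ≢i; splitAt⁻¹-↑ˡ; splitAt⁻¹-↑ʳ)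
open import Data.Vec.Functional using (Vector; _∷_; _++_; head; tail; take; drop; removeAt; replicate)
open import Data.Vec.Functional.Properties using (lookup-++ˡ; lookup-++ʳ)
open import Data.List using (List; []; map; concatMap; filter; length; tabulate) renaming (_∷_ to _∷ᴸ_)
open import Data.List.Properties using (filter-accept; filter-none; filter-++; length-++; map-tabulate)
import Data.List.Relation.Unary.All as All
open import Data.Product using (∃; _×_; _,_; proj₁; proj₂; map₂)
open import Data.Sum using (inj₁; inj₂)
open import Data.Bool using (true; false)
open import Level using (Level; 0ℓ)
open import Algebra.Bundles using (Monoid; CommutativeMonoid; CommutativeRing)
import Algebra.Properties.CommutativeMonoid.Sum
open import Relation.Nullary using (does; yes; no)
open import Data.Empty using (⊥-elim)
open import Relation.Unary using (Pred; Decidable)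
open import Relation.Binary.PropositionalEquality
  using (_≡_; _≢_; _≗_; refl; sym; trans; cong; cong₂; subst; module ≡-Reasoning)
open import Function using (_∘_; id; _⇔_; mk⇔; Equivalence; Inverse)

private variable
  α β p : Level
  A : Set α
  B : Set β

module _ {c ℓ} (M : Monoid c ℓ) where
  open Monoid M using (Carrier; _≈_; _∙_; ε; ∙-congˡ; identityˡ; assoc; setoid)
  open import Algebra.Properties.Monoid.Sum M using (sum)
  open import Relation.Binary.Reasoning.Setoid setoid

  sum-take-drop : ∀ t {m} (f : Vector Carrier (t ℕ.+ m)) → sum f ≈ sum (take t f) ∙ sum (drop t f)
  sum-take-drop ℕ.zero    f = begin
    sum f      ≈⟨ identityˡ (sum f) ⟨
    ε ∙ sum f  ∎
  sum-take-drop (ℕ.suc t) f = begin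
    head f ∙ sum (tail f)                                        ≈⟨ ∙-congˡ (sum-take-drop t (tail f)) ⟩
    head f ∙ (sum (take t (tail f)) ∙ sum (drop t (tail f)))     ≈⟨ assoc _ _ _ ⟨
    head f ∙ sum (take t (tail f)) ∙ sum (drop t (tail f))       ∎

module _ {c ℓ} (M : CommutativeMonoid c ℓ) where
  open CommutativeMonoid M using (Carrier; _≈_; _∙_; ε; ∙-congˡ; identityʳ; setoid)
  open import Algebra.Properties.CommutativeMonoid.Sum M using (sum; sum-remove; sum-cong-≋; sum-replicate-zero)
  open import Relation.Binary.Reasoning.Setoid setoid

  sum-single : ∀ {n} (f : Vector Carrier n) i → (∀ j → j ≢ i → f j ≈ ε) → sum f ≈ f i
  sum-single {ℕ.suc n} f i f≈ε = begin
    sum f                      ≈⟨ sum-remove {i = i} f ⟩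
    f i ∙ sum (removeAt f i)   ≈⟨ ∙-congˡ (sum-cong-≋ (λ j → f≈ε _ (punchInᵢ≢i i j))) ⟩
    f i ∙ sum (replicate n ε)  ≈⟨ ∙-congˡ (sum-replicate-zero n) ⟩
    f i ∙ ε                    ≈⟨ identityʳ (f i) ⟩
    f i                        ∎

≗-++ : ∀ t {m} (w : Vector A (t ℕ.+ m)) {u y} → take t w ≗ u → drop t w ≗ y → w ≗ u ++ y
≗-++ t w w↑ˡ w↑ʳ i with splitAt t i in eq
... | inj₁ j = trans (cong w (sym (splitAt⁻¹-↑ˡ eq))) (w↑ˡ j)
... | inj₂ k = trans (cong w (sym (splitAt⁻¹-↑ʳ eq))) (w↑ʳ k)

module _ {P : Pred B p} (P? : Decidable P) where

  length-filter-map : (f : A → B) (xs : List A) →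
                      length (filter P? (map f xs)) ≡ length (filter (P? ∘ f) xs)
  length-filter-map f []       = refl
  length-filter-map f (x ∷ᴸ xs) with does (P? (f x))
  ... | true  = cong ℕ.suc (length-filter-map f xs)
  ... | false = length-filter-map f xs

  length-filter-concatMap : (f : A → List B) (xs : List A) →
    length (filter P? (concatMap f xs)) ≡ Listℕ.sum (map (length ∘ filter P? ∘ f) xs)
  length-filter-concatMap f []       = refl
  length-filter-concatMap f (x ∷ᴸ xs) =
    trans (cong length (filter-++ P? (f x) (concatMap f xs)))
          (trans (length-++ (filter P? (f x)))
                 (cong (length (filter P? (f x)) ℕ.+_) (length-filter-concatMap f xs)))

module ℕΣ = Algebra.Properties.CommutativeMonoid.Sum +-0-commutativeMonoid

sum-tabulate : ∀ {n} (f : Fin n → ℕ) → Listℕ.sum (tabulate f) ≡ ℕΣ.sum f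
sum-tabulate {ℕ.zero}  f = refl
sum-tabulate {ℕ.suc n} f = cong (f zero ℕ.+_) (sum-tabulate (tail f))

module _ {q : ℕ} (F : FiniteField q) where
  open FiniteField F
  open Inverse enum using (to; from; inverseˡ; inverseʳ)

  sum-map-elements : (h : Carrier → ℕ) (c₀ : Carrier) → (∀ c → c ≢ c₀ → h c ≡ 0) →
                 Listℕ.sum (map h elements) ≡ h c₀
  sum-map-elements h c₀ h≡0 = begin
    Listℕ.sum (map h (map to (tabulate id)))  ≡⟨ cong (Listℕ.sum ∘ map h) (map-tabulate id to) ⟩
    Listℕ.sum (map h (tabulate to))           ≡⟨ cong Listℕ.sum (map-tabulate to h) ⟩
    Listℕ.sum (tabulate (h ∘ to))             ≡⟨ sum-tabulate (h ∘ to) ⟩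
    ℕΣ.sum (h ∘ to)                           ≡⟨ sum-single +-0-commutativeMonoid (h ∘ to) (from c₀) h∘to≡0 ⟩
    h (to (from c₀))                          ≡⟨ cong h (inverseˡ refl) ⟩
    h c₀                                      ∎
    where
    open ≡-Reasoning
    h∘to≡0 : ∀ i → i ≢ from c₀ → h (to i) ≡ 0
    h∘to≡0 i i≢ = h≡0 (to i) (λ to-i≡c₀ → i≢ (sym (inverseʳ (sym to-i≡c₀))))

  length-filter-allVects : ∀ n {P : Pred (Vect n) p} (P? : Decidable P) (x₀ : Vect n) →
                 (∀ x → P x ⇔ x ≗ x₀) → length (filter P? (allVects n)) ≡ 1
  length-filter-allVects ℕ.zero P? x₀ P⇔≗x₀ =
    cong length (filter-accept P? (Equivalence.from (P⇔≗x₀ _) λ ()))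
  length-filter-allVects (ℕ.suc n) {P} P? x₀ P⇔≗x₀ =
    count-cons _ (λ c x → λ { zero → refl ; (suc i) → refl })
    where
    -- allVects conses with a where-bound function that cannot be named here, so the step abstracts over it.
    count-cons : (cons : Carrier → Vect n → Vect (ℕ.suc n)) → (∀ c x → cons c x ≗ c ∷ x) →
                 length (filter P? (concatMap (λ c → map (cons c) (allVects n)) elements)) ≡ 1
    count-cons cons cons≗∷ = begin
      length (filter P? (concatMap (λ c → map (cons c) (allVects n)) elements))
        ≡⟨ length-filter-concatMap P? _ elements ⟩
      Listℕ.sum (map (λ c → length (filter P? (map (cons c) (allVects n)))) elements)
        ≡⟨ sum-map-elements _ (head x₀) count-other-head ⟩
      length (filter P? (map (cons (head x₀)) (allVects n)))
        ≡⟨ length-filter-map P? (cons (head x₀)) (allVects n) ⟩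
      length (filter (P? ∘ cons (head x₀)) (allVects n))
        ≡⟨ length-filter-allVects n (P? ∘ cons (head x₀)) (tail x₀) tail-unique ⟩
      1 ∎
      where
      open ≡-Reasoning
      head-forced : ∀ {c x} → P (cons c x) → c ≡ head x₀
      head-forced {c} {x} Pcx = trans (sym (cons≗∷ c x zero)) (Equivalence.to (P⇔≗x₀ _) Pcx zero)

      count-other-head : ∀ c → c ≢ head x₀ → length (filter P? (map (cons c) (allVects n))) ≡ 0
      count-other-head c c≢ = trans (length-filter-map P? (cons c) (allVects n))
        (cong length (filter-none (P? ∘ cons c) (All.universal (λ _ → c≢ ∘ head-forced) (allVects n))))

      tail-unique : ∀ x → P (cons (head x₀) x) ⇔ x ≗ tail x₀
      tail-unique x = mk⇔
        (λ Pcx i → trans (sym (cons≗∷ _ x (suc i))) (Equivalence.to (P⇔≗x₀ _) Pcx (suc i)))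
        (λ x≗ → Equivalence.from (P⇔≗x₀ _) λ { zero → cons≗∷ _ x zero
                                               ; (suc i) → trans (cons≗∷ _ x (suc i)) (x≗ i) })

  ring : CommutativeRing 0ℓ 0ℓ
  ring = record { isCommutativeRing = isCommutativeRing }

  open CommutativeRing ring
    using (_-_; *-assoc; *-identityʳ; zeroʳ; semiring; +-commutativeMonoid; +-monoid; +-group)
  open import Algebra.Properties.Semiring.Sum semiring
    using (sum; sum-cong-≗; ∑-comm; *-distribˡ-sum; *-distribʳ-sum)
  open import Algebra.Properties.Group +-group using (//-rightDividesˡ; //-rightDividesʳ)

  infixl 7 _·_
  _·_ : ∀ {n k} → Vect n → Mat n k → Vect k
  (v · A) j = sum λ i → v i *ᶠ A i j

  infix 4 _≐_
  _≐_ : ∀ {m n} → Mat m n → Mat m n → Set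
  A ≐ B = ∀ i j → A i j ≡ B i j

  sumF≡sum : ∀ {n} (f : Vect n) → sumF f ≡ sum f
  sumF≡sum {ℕ.zero}  f = refl
  sumF≡sum {ℕ.suc n} f = cong (f zero +_) (sumF≡sum (tail f))

  ·-congˡ : ∀ {n k} {v v′ : Vect n} (A : Mat n k) → v ≗ v′ → v · A ≗ v′ · A
  ·-congˡ A v≗v′ j = sum-cong-≗ λ i → cong (_*ᶠ A i j) (v≗v′ i)

  ·-identityʳ : ∀ {n} (v : Vect n) → v · I ≗ v
  ·-identityʳ v j = begin
    sum (λ i → v i *ᶠ I i j)  ≡⟨ sum-single +-commutativeMonoid _ j off-diagonal ⟩
    v j *ᶠ I j j              ≡⟨ cong (v j *ᶠ_) (I-diagonal j) ⟩
    v j *ᶠ 1#                 ≡⟨ *-identityʳ (v j) ⟩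
    v j                       ∎
    where
    open ≡-Reasoning
    I-diagonal : ∀ {n} (i : Fin n) → I i i ≡ 1#
    I-diagonal i with i ≟ᶠ i
    ... | yes _   = refl
    ... | no i≢i  = ⊥-elim (i≢i refl)
    off-diagonal : ∀ i → i ≢ j → v i *ᶠ I i j ≡ 0#
    off-diagonal i i≢j with i ≟ᶠ j
    ... | yes i≡j = ⊥-elim (i≢j i≡j)
    ... | no _    = zeroʳ (v i)

  ·-assoc : ∀ {n k l} (v : Vect n) (A : Mat n k) (B : Mat k l) → (v · A) · B ≗ v · (A ⊗ B)
  ·-assoc v A B c = begin
    sum (λ j → sum (λ i → v i *ᶠ A i j) *ᶠ B j c)
      ≡⟨ sum-cong-≗ (λ j → *-distribʳ-sum (B j c) (λ i → v i *ᶠ A i j)) ⟩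
    sum (λ j → sum (λ i → v i *ᶠ A i j *ᶠ B j c))
      ≡⟨ ∑-comm (λ j i → v i *ᶠ A i j *ᶠ B j c) ⟩
    sum (λ i → sum (λ j → v i *ᶠ A i j *ᶠ B j c))
      ≡⟨ sum-cong-≗ (λ i → sum-cong-≗ (λ j → *-assoc (v i) (A i j) (B j c))) ⟩
    sum (λ i → sum (λ j → v i *ᶠ (A i j *ᶠ B j c)))
      ≡⟨ sum-cong-≗ (λ i → *-distribˡ-sum (v i) (λ j → A i j *ᶠ B j c)) ⟨
    sum (λ i → v i *ᶠ sum (λ j → A i j *ᶠ B j c))
      ≡⟨ sum-cong-≗ (λ i → cong (v i *ᶠ_) (sumF≡sum (λ j → A i j *ᶠ B j c))) ⟨
    (v · (A ⊗ B)) c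
      ∎
    where open ≡-Reasoning

  ·-inverseʳ : ∀ {n k} (A : Mat n k) (B : Mat k n) → A ⊗ B ≐ I → ∀ v → v · A · B ≗ v
  ·-inverseʳ A B AB≐I v i = begin
    (v · A · B) i    ≡⟨ ·-assoc v A B i ⟩
    (v · (A ⊗ B)) i  ≡⟨ sum-cong-≗ (λ j → cong (v j *ᶠ_) (AB≐I j i)) ⟩
    (v · I) i        ≡⟨ ·-identityʳ v i ⟩
    v i              ∎
    where open ≡-Reasoning

  ·-take-drop : ∀ t {m k} (v : Vect (t ℕ.+ m)) (A : Mat (t ℕ.+ m) k) j →
                (v · A) j ≡ (take t v · take t A) j + (drop t v · drop t A) j
  ·-take-drop t v A j = sum-take-drop +-monoid t (λ i → v i *ᶠ A i j)

  x+c≡a⇒x≡a-c : ∀ {x c a} → x + c ≡ a → x ≡ a - c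
  x+c≡a⇒x≡a-c {x} {c} x+c≡a = trans (sym (//-rightDividesʳ c x)) (cong (_- c) x+c≡a)

  fibre-singleton : ∀ {t m} (M M⁻¹ : Mat (t ℕ.+ m) (t ℕ.+ m)) → M ⊗ M⁻¹ ≐ I → M⁻¹ ⊗ M ≐ I →
    (T : Fin t → Fin (t ℕ.+ m)) → Invertible (λ i j → M (i ↑ˡ m) (T j)) →
    ∀ a y → ∃ λ x₀ → ∀ x → (x ∘ T ≗ a × drop t (x · M⁻¹) ≗ y) ⇔ x ≗ x₀
  fibre-singleton {t} {m} M M⁻¹ MM⁻¹≐I M⁻¹M≐I T (Q , PQ≐I , QP≐I) a y =
    x₀ , λ x → mk⇔ (solves⇒≗x₀ x) (≗x₀⇒solves x)
    where
    open ≡-Reasoning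
    P : Mat t t
    P i j = M (i ↑ˡ m) (T j)
    R : Mat m t
    R k j = M (t ↑ʳ k) (T j)

    columns-T : ∀ w j → (w · M) (T j) ≡ (take t w · P) j + (drop t w · R) j
    columns-T w j = ·-take-drop t w M (T j)

    b : Vect t
    b j = a j - (y · R) j
    u : Vect t
    u = b · Q
    x₀ : Vect (t ℕ.+ m)
    x₀ = (u ++ y) · M

    x₀-on-T : ∀ j → x₀ (T j) ≡ a j
    x₀-on-T j = begin
      x₀ (T j)                                            ≡⟨ columns-T (u ++ y) j ⟩
      (take t (u ++ y) · P) j + (drop t (u ++ y) · R) j   ≡⟨ cong₂ _+_ (·-congˡ P (lookup-++ˡ u y) j)
                                                                        (·-congˡ R (lookup-++ʳ u y) j) ⟩
      (u · P) j + (y · R) j                               ≡⟨ cong (_+ (y · R) j) (·-inverseʳ Q P QP≐I b j) ⟩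
      a j - (y · R) j + (y · R) j                         ≡⟨ //-rightDividesˡ ((y · R) j) (a j) ⟩
      a j                                                 ∎

    x₀-tail : drop t (x₀ · M⁻¹) ≗ y
    x₀-tail k = trans (·-inverseʳ M M⁻¹ MM⁻¹≐I (u ++ y) (t ↑ʳ k)) (lookup-++ʳ u y k)

    ≗x₀⇒solves : ∀ x → x ≗ x₀ → x ∘ T ≗ a × drop t (x · M⁻¹) ≗ y
    ≗x₀⇒solves x x≗x₀ = (λ j → trans (x≗x₀ (T j)) (x₀-on-T j))
                      , (λ k → trans (·-congˡ M⁻¹ x≗x₀ (t ↑ʳ k)) (x₀-tail k))

    solves⇒≗x₀ : ∀ x → x ∘ T ≗ a × drop t (x · M⁻¹) ≗ y → x ≗ x₀
    solves⇒≗x₀ x (x∘T≗a , w-tail≗y) i =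
      trans (sym (·-inverseʳ M⁻¹ M M⁻¹M≐I x i)) (·-congˡ M w≗u++y i)
      where
      w : Vect (t ℕ.+ m)
      w = x · M⁻¹
      w-head-system : ∀ j → (take t w · P) j + (y · R) j ≡ a j
      w-head-system j = begin
        (take t w · P) j + (y · R) j         ≡⟨ cong ((take t w · P) j +_) (·-congˡ R w-tail≗y j) ⟨
        (take t w · P) j + (drop t w · R) j  ≡⟨ columns-T w j ⟨
        (w · M) (T j)                        ≡⟨ ·-inverseʳ M⁻¹ M M⁻¹M≐I x (T j) ⟩
        x (T j)                              ≡⟨ x∘T≗a j ⟩
        a j                                  ∎
      w-head : take t w ≗ u
      w-head i = trans (sym (·-inverseʳ P Q PQ≐I (take t w) i))
                       (·-congˡ Q (x+c≡a⇒x≡a-c ∘ w-head-system) i)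
      w≗u++y : w ≗ u ++ y
      w≗u++y = ≗-++ t w w-head w-tail≗y

  aont⇒resilient : ∀ t m → LinearAONT t (t ℕ.+ m) → LinearResilient (t ℕ.+ m) m t
  aont⇒resilient t m (M , (M⁻¹ , MM⁻¹≐I , M⁻¹M≐I) , minors) = N , resilient
    where
    N : Mat m (t ℕ.+ m)
    N j i = M⁻¹ i (t ↑ʳ j)

    f : Vect (t ℕ.+ m) → Vect m
    f x j = sumF λ i → x i *ᶠ N j i

    f≗tail : ∀ x → f x ≗ drop t (x · M⁻¹)
    f≗tail x j = sumF≡sum (λ i → x i *ᶠ N j i)

    resilient : Resilient (t ℕ.+ m) m t f
    resilient T T-injective a y = begin
      countFix f T a y * q ^ m  ≡⟨ cong (_* q ^ m) (length-filter-allVects (t ℕ.+ m) _ x₀ fibre) ⟩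
      1 * q ^ m                 ≡⟨ *-identityˡ (q ^ m) ⟩
      q ^ m                     ≡⟨ cong (q ^_) (m+n∸m≡n t m) ⟨
      q ^ (t ℕ.+ m ∸ t)         ∎
      where
      open ≡-Reasoning
      minor-invertible : Invertible (λ i j → M (i ↑ˡ m) (T j))
      minor-invertible = minors (_↑ˡ m) T (↑ˡ-injective m _ _) T-injective
      singleton : ∃ λ x₀ → ∀ x → (x ∘ T ≗ a × drop t (x · M⁻¹) ≗ y) ⇔ x ≗ x₀
      singleton = fibre-singleton M M⁻¹ MM⁻¹≐I M⁻¹M≐I T minor-invertible a y
      x₀ : Vect (t ℕ.+ m)
      x₀ = proj₁ singleton
      fibre : ∀ x → (x ∘ T ≗ a × f x ≗ y) ⇔ x ≗ x₀
      fibre x = mk⇔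
        (λ (x∘T≗a , fx≗y) → Equivalence.to (proj₂ singleton x)
                               (x∘T≗a , λ j → trans (sym (f≗tail x j)) (fx≗y j)))
        (λ x≗x₀ → map₂ (λ tail≗y j → trans (f≗tail x j) (tail≗y j))
                       (Equivalence.from (proj₂ singleton x) x≗x₀))

theorem21 : (q : ℕ) → IsPrimePower q → (F : FiniteField q) →
    (t s : ℕ) → 1 ≤ t → t ≤ s →
    FiniteField.LinearAONT F t s → FiniteField.LinearResilient F s (s ∸ t) t
theorem21 q _ F t s _ t≤s =
  subst (λ n → FiniteField.LinearAONT F t n → FiniteField.LinearResilient F n (s ∸ t) t)
        (m+[n∸m]≡n t≤s) (aont⇒resilient F t (s ∸ t))
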